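{- Let $n\ge5$ and $s$ be integers with $1<s<n/2$, let $q=\lfloor n/s\rfloor$ and $r=n-qs$. If $r\le q$ or $r+q\ge s+1$, then $$\sum_{i\in\mathbb{Z}_n}d(0,i)\ge\left\lfloor\frac{(s+1)^2}{2}\right\rfloor,$$ where $d(0,i)$ denotes the distance between $0$ and $i$ in $C_n(1,s)$.
   Context: The circulant graph $C_n(1,s)$ has vertex set $\mathbb{Z}_n$, with $i,j$ adjacent iff $i-j\in\{\pm1,\pm s\}$ mod $n$. -}

module Defs where

open import Data.Nat using (ℕ; zero; suc; _+_; _*_; _≤_; _<_)
open import Data.Product using (_×_; ∃-syntax)
open import Data.Sum using (_⊎_)
open import Data.List using (List; map; upTo)
open import Data.Nat.ListAction using (sum)
open import Relation.Binary.PropositionalEquality using (_≡_)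

-- Vertices of C_n(1,s) are represented by the naturals 0,…,n-1 (= ℤ_n).
-- "b = a + t (mod n)" for 0 ≤ a,b < n and 0 < t < n: since a + t < 2n,
-- this holds iff a + t ≡ b or a + t ≡ b + n.
PlusMod : ℕ → ℕ → ℕ → ℕ → Set
PlusMod n t a b = (a + t ≡ b) ⊎ (a + t ≡ b + n)

Gen : ℕ → ℕ → Set
Gen s t = (t ≡ 1) ⊎ (t ≡ s)

Adj : ℕ → ℕ → ℕ → ℕ → Set
Adj n s a b = ∃[ t ] (Gen s t × (PlusMod n t a b ⊎ PlusMod n t b a))

data Walk (n s : ℕ) (a : ℕ) : ℕ → ℕ → Set where
  here : Walk n s a a 0
  step : ∀ {b c k} → Walk n s a b k → c < n → Adj n s b c → Walk n s a c (suc k)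

IsDistFrom0 : ℕ → ℕ → (ℕ → ℕ) → Set
IsDistFrom0 n s d =
  ∀ i → i < n → Walk n s 0 i (d i) × (∀ k → Walk n s 0 i k → d i ≤ k)

distSum : ℕ → (ℕ → ℕ) → ℕ
distSum n d = sum (map d (upTo n))

-- A walk of length k from 0 to v lifts to an identity v = a + b s + m n over ℤ
-- with |a| + |b| ≤ k. Writing n = q s + r and comparing the coefficients of s,
-- the condition on q and r forces |a| + |b| ≥ min(v, s + 1 − v) for 1 ≤ v ≤ s;
-- negating the identity gives the same bound at the vertex n − v. Since 2s < n
-- these 2s vertices are distinct, and Σ_{v=1}^{s} min(v, s + 1 − v) = ⌊(s+1)²/4⌋.
module Submission where

open import Defs
open import Data.Nat using (ℕ; zero; suc; _+_; _*_; _≤_; _<_; z≤n; s≤s; s≤s⁻¹; _≤?_; _/_)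
open import Data.Nat.Properties
  using (≤-refl; ≤-trans; ≤-reflexive; m≤m+n; n≤1+n; +-mono-≤; +-monoʳ-≤; +-monoʳ-<;
         +-cancelˡ-≤; +-cancelʳ-≡; +-comm; +-assoc; +-suc; *-cancelʳ-<; *-cancelˡ-≤; ≰⇒>; m≤n⇒∃[o]m+o≡n;
         <-trans; ≤-<-trans; module ≤-Reasoning)
open import Data.Nat.DivMod using (m<n*o⇒m/o<n)
open import Data.Nat.ListAction using (sum)
open import Data.Nat.ListAction.Properties using (sum-++)
open import Data.Nat.Tactic.RingSolver using (solve)
open import Data.List using ([]; _∷_; applyUpTo)
open import Data.List.Properties using (map-upTo; applyUpTo-∷ʳ)
open import Data.Product using (_,_; proj₁)
open import Data.Sum using (_⊎_; inj₁; inj₂)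
open import Function using (_∘_)
open import Relation.Nullary using (Dec; yes; no)
open import Relation.Binary.PropositionalEquality using (_≡_; refl; sym; trans; cong; cong₂; subst; subst₂)

-- A goal L ≡ R that is a linear consequence of A ≡ B: the ring solver proves L + A ≡ R + B.
+-cancel-≡ : ∀ {L R A B} → A ≡ B → L + A ≡ R + B → L ≡ R
+-cancel-≡ {L} {R} {A} refl e = +-cancelʳ-≡ A L R e

≤-slack : ∀ {m n} W → n ≡ m + W → m ≤ n
≤-slack {m} W refl = m≤m+n m W

-- v = (a⁺ − a⁻) + (b⁺ − b⁻) s + (m⁺ − m⁻) n in ℤ, using at most k steps ±1, ±s.
record Lift (n s v k : ℕ) : Set where
  constructor lift
  field
    a⁺ a⁻ b⁺ b⁻ m⁻ m⁺ : ℕ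
    lifts : v + (a⁻ + b⁻ * s + m⁻ * n) ≡ a⁺ + b⁺ * s + m⁺ * n
    short : a⁺ + a⁻ + b⁺ + b⁻ ≤ k

lift-step : ∀ {n s b c k} → Lift n s b k → Adj n s b c → Lift n s c (suc k)
lift-step {n} {s} {b} {c} {k} (lift a⁺ a⁻ b⁺ b⁻ m⁻ m⁺ eq bd) (_ , gen , dir) = along gen dir
  where
  one-more : ∀ {x} → x ≡ suc (a⁺ + a⁻ + b⁺ + b⁻) → x ≤ suc k
  one-more e = ≤-trans (≤-reflexive e) (s≤s bd)

  along : ∀ {t} → Gen s t → PlusMod n t b c ⊎ PlusMod n t c b → Lift n s c (suc k)
  along (inj₁ refl) (inj₁ (inj₁ f)) = lift (suc a⁺) a⁻ b⁺ b⁻ m⁻ m⁺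
    (+-cancel-≡ (cong₂ _+_ (sym eq) f) (solve (n ∷ s ∷ b ∷ c ∷ a⁺ ∷ a⁻ ∷ b⁺ ∷ b⁻ ∷ m⁻ ∷ m⁺ ∷ [])))
    (one-more refl)
  along (inj₂ refl) (inj₁ (inj₁ f)) = lift a⁺ a⁻ (suc b⁺) b⁻ m⁻ m⁺
    (+-cancel-≡ (cong₂ _+_ (sym eq) f) (solve (n ∷ s ∷ b ∷ c ∷ a⁺ ∷ a⁻ ∷ b⁺ ∷ b⁻ ∷ m⁻ ∷ m⁺ ∷ [])))
    (one-more (solve (a⁺ ∷ a⁻ ∷ b⁺ ∷ b⁻ ∷ [])))
  along (inj₁ refl) (inj₁ (inj₂ f)) = lift (suc a⁺) a⁻ b⁺ b⁻ (suc m⁻) m⁺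
    (+-cancel-≡ (cong₂ _+_ (sym eq) f) (solve (n ∷ s ∷ b ∷ c ∷ a⁺ ∷ a⁻ ∷ b⁺ ∷ b⁻ ∷ m⁻ ∷ m⁺ ∷ [])))
    (one-more refl)
  along (inj₂ refl) (inj₁ (inj₂ f)) = lift a⁺ a⁻ (suc b⁺) b⁻ (suc m⁻) m⁺
    (+-cancel-≡ (cong₂ _+_ (sym eq) f) (solve (n ∷ s ∷ b ∷ c ∷ a⁺ ∷ a⁻ ∷ b⁺ ∷ b⁻ ∷ m⁻ ∷ m⁺ ∷ [])))
    (one-more (solve (a⁺ ∷ a⁻ ∷ b⁺ ∷ b⁻ ∷ [])))
  along (inj₁ refl) (inj₂ (inj₁ f)) = lift a⁺ (suc a⁻) b⁺ b⁻ m⁻ m⁺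
    (+-cancel-≡ (cong₂ _+_ (sym eq) (sym f)) (solve (n ∷ s ∷ b ∷ c ∷ a⁺ ∷ a⁻ ∷ b⁺ ∷ b⁻ ∷ m⁻ ∷ m⁺ ∷ [])))
    (one-more (solve (a⁺ ∷ a⁻ ∷ b⁺ ∷ b⁻ ∷ [])))
  along (inj₂ refl) (inj₂ (inj₁ f)) = lift a⁺ a⁻ b⁺ (suc b⁻) m⁻ m⁺
    (+-cancel-≡ (cong₂ _+_ (sym eq) (sym f)) (solve (n ∷ s ∷ b ∷ c ∷ a⁺ ∷ a⁻ ∷ b⁺ ∷ b⁻ ∷ m⁻ ∷ m⁺ ∷ [])))
    (one-more (solve (a⁺ ∷ a⁻ ∷ b⁺ ∷ b⁻ ∷ [])))
  along (inj₁ refl) (inj₂ (inj₂ f)) = lift a⁺ (suc a⁻) b⁺ b⁻ m⁻ (suc m⁺)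
    (+-cancel-≡ (cong₂ _+_ (sym eq) (sym f)) (solve (n ∷ s ∷ b ∷ c ∷ a⁺ ∷ a⁻ ∷ b⁺ ∷ b⁻ ∷ m⁻ ∷ m⁺ ∷ [])))
    (one-more (solve (a⁺ ∷ a⁻ ∷ b⁺ ∷ b⁻ ∷ [])))
  along (inj₂ refl) (inj₂ (inj₂ f)) = lift a⁺ a⁻ b⁺ (suc b⁻) m⁻ (suc m⁺)
    (+-cancel-≡ (cong₂ _+_ (sym eq) (sym f)) (solve (n ∷ s ∷ b ∷ c ∷ a⁺ ∷ a⁻ ∷ b⁺ ∷ b⁻ ∷ m⁻ ∷ m⁺ ∷ [])))
    (one-more (solve (a⁺ ∷ a⁻ ∷ b⁺ ∷ b⁻ ∷ [])))

walk⇒lift : ∀ {n s v k} → Walk n s 0 v k → Lift n s v k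
walk⇒lift here         = lift 0 0 0 0 0 0 refl z≤n
walk⇒lift (step w _ a) = lift-step (walk⇒lift w) a

lift-neg : ∀ {n s v j k} → v + j ≡ n → Lift n s v k → Lift n s j k
lift-neg {n} {s} {v} {j} {k} vj (lift a⁺ a⁻ b⁺ b⁻ m⁻ m⁺ eq bd) = lift a⁻ a⁺ b⁻ b⁺ m⁺ (suc m⁻)
  (+-cancel-≡ (cong₂ _+_ eq (sym vj)) (solve (n ∷ s ∷ v ∷ j ∷ a⁺ ∷ a⁻ ∷ b⁺ ∷ b⁻ ∷ m⁻ ∷ m⁺ ∷ [])))
  (subst (_≤ k) reorder bd)
  where
  reorder : a⁺ + a⁻ + b⁺ + b⁻ ≡ a⁻ + a⁺ + b⁻ + b⁺
  reorder = solve (a⁺ ∷ a⁻ ∷ b⁺ ∷ b⁻ ∷ [])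

-- k ≥ min(i, s + 1 − i), avoiding truncated subtraction.
TentBound : ℕ → ℕ → ℕ → Set
TentBound s i k = i ≤ k ⊎ s + 1 ≤ i + k

TentBound-mono : ∀ {s i k l} → k ≤ l → TentBound s i k → TentBound s i l
TentBound-mono         k≤l (inj₁ i≤k)   = inj₁ (≤-trans i≤k k≤l)
TentBound-mono {i = i} k≤l (inj₂ s<i+k) = inj₂ (≤-trans s<i+k (+-monoʳ-≤ i k≤l))

TentBound-reflect : ∀ {s i j k} → i + j ≡ s + 1 → TentBound s i k → TentBound s j k
TentBound-reflect {j = j} {k} i+j (inj₁ i≤k) =
  inj₂ (subst₂ _≤_ i+j (+-comm k j) (+-mono-≤ i≤k (≤-refl {j})))
TentBound-reflect {i = i} {j} {k} i+j (inj₂ s<i+k) =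
  inj₁ (+-cancelˡ-≤ i j k (subst (_≤ i + k) (sym i+j) s<i+k))

-- Here s = 1 + r + u and m⁻ = m⁺ + c, so expanding n = q s + r the identity becomes
-- i + a⁻ + c r + (b⁻ + c q) s = a⁺ + b⁺ s. If b⁺ ≤ b⁻ + c q this forces a⁺ ≥ i.
tent-windingDown : ∀ r u q i a⁺ a⁻ b⁺ b⁻ m c → r ≤ q ⊎ suc (r + u) + 1 ≤ r + q →
  i + (a⁻ + b⁻ * suc (r + u) + (m + c) * (q * suc (r + u) + r))
    ≡ a⁺ + b⁺ * suc (r + u) + m * (q * suc (r + u) + r) →
  TentBound (suc (r + u)) i (a⁺ + a⁻ + b⁺ + b⁻)
tent-windingDown r u q i a⁺ a⁻ b⁺ b⁻ m c H E with b⁺ ≤? b⁻ + c * q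
... | yes b⁺≤ with m≤n⇒∃[o]m+o≡n b⁺≤
...   | t , T = inj₁ (≤-slack (2 * a⁻ + b⁺ + b⁻ + c * r + r * t + t + t * u)
        (+-cancel-≡ (cong₂ _+_ E (cong (_* suc (r + u)) T))
          (solve (r ∷ u ∷ q ∷ i ∷ a⁺ ∷ a⁻ ∷ b⁺ ∷ b⁻ ∷ m ∷ c ∷ t ∷ []))))
tent-windingDown r u q i a⁺ a⁻ b⁺ b⁻ m c H E | no b⁺≰ with m≤n⇒∃[o]m+o≡n (≰⇒> b⁺≰)
...   | d , refl = overshoot H
  where
  -- Now i + a⁻ + c r = a⁺ + (1 + d) s. If r ≤ q then i + a⁻ + b⁺ > (1 + d) s; if c ≤ d
  -- then i + a⁻ ≥ s; if c > d and r + q ≥ s + 1 then a⁺ + b⁺ ≥ i + c (r + q) − (1 + d) s ≥ i.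
  overshoot : r ≤ q ⊎ suc (r + u) + 1 ≤ r + q →
    TentBound (suc (r + u)) i (a⁺ + a⁻ + suc (b⁻ + c * q + d) + b⁻)
  overshoot (inj₁ r≤q) with m≤n⇒∃[o]m+o≡n r≤q
  ... | v , refl = inj₂ (≤-slack (2 * a⁺ + 2 * b⁻ + c * v + 2 * d + d * r + d * u)
        (+-cancel-≡ (sym E) (solve (r ∷ u ∷ v ∷ i ∷ a⁺ ∷ a⁻ ∷ b⁻ ∷ m ∷ c ∷ d ∷ []))))
  overshoot (inj₂ s<r+q) with m≤n⇒∃[o]m+o≡n s<r+q | c ≤? d
  ... | _ , _ | yes c≤d with m≤n⇒∃[o]m+o≡n c≤d
  ...   | f , refl = inj₂ (≤-slack (2 * a⁺ + 2 * b⁻ + 2 * c + c * q + c * u + 2 * f + f * r + f * u)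
          (+-cancel-≡ (sym E) (solve (r ∷ u ∷ q ∷ i ∷ a⁺ ∷ a⁻ ∷ b⁻ ∷ m ∷ c ∷ f ∷ []))))
  overshoot (inj₂ s<r+q) | e , e-eq | no c≰d with m≤n⇒∃[o]m+o≡n (≰⇒> c≰d)
  ...   | g , refl = inj₁ (≤-slack (2 + 2 * a⁻ + 2 * b⁻ + 2 * d + d * e + e + e * g + 2 * g + g * r + g * u)
          (+-cancel-≡ (cong₂ _+_ E (cong ((suc d + g) *_) e-eq))
            (solve (r ∷ u ∷ q ∷ e ∷ i ∷ a⁺ ∷ a⁻ ∷ b⁻ ∷ m ∷ d ∷ g ∷ []))))

-- With m⁺ = m⁻ + 1 + c the identity becomes i + a⁻ + b⁻ s = a⁺ + (b⁺ + (1 + c) q) s + (1 + c) r.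
-- If b⁻ < b⁺ + (1 + c) q then i + a⁻ ≥ (1 + d) s where b⁻ + 1 + d = b⁺ + (1 + c) q ≥ 2,
-- so i + a⁻ + b⁻ ≥ s + 1.
tent-windingUp : ∀ r u q i a⁺ a⁻ b⁺ b⁻ m c → r ≤ q ⊎ suc (r + u) + 1 ≤ r + q → 2 ≤ q →
  i + (a⁻ + b⁻ * suc (r + u) + m * (q * suc (r + u) + r))
    ≡ a⁺ + b⁺ * suc (r + u) + suc (m + c) * (q * suc (r + u) + r) →
  TentBound (suc (r + u)) i (a⁺ + a⁻ + b⁺ + b⁻)
tent-windingUp r u q i a⁺ a⁻ b⁺ b⁻ m c H q≥2 E with b⁺ + suc c * q ≤? b⁻
... | yes ≤b⁻ with m≤n⇒∃[o]m+o≡n ≤b⁻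
...   | g , refl = undershoot H
  where
  -- Now i + a⁻ + g s = a⁺ + (1 + c) r. If r ≤ q then a⁺ + b⁻ ≥ a⁺ + (1 + c) r ≥ i; if 1 + c ≤ g
  -- then a⁺ ≥ i; if g < 1 + c and r + q ≥ s + 1 then i + a⁻ + b⁻ ≥ (1 + c)(r + q) − g (s − 1) > s.
  undershoot : r ≤ q ⊎ suc (r + u) + 1 ≤ r + q →
    TentBound (suc (r + u)) i (a⁺ + a⁻ + b⁺ + (b⁺ + suc c * q + g))
  undershoot (inj₁ r≤q) with m≤n⇒∃[o]m+o≡n r≤q
  ... | v , refl = inj₁ (≤-slack (2 * a⁻ + 2 * b⁺ + c * v + 2 * g + g * r + g * u + v)
        (+-cancel-≡ E (solve (r ∷ u ∷ v ∷ i ∷ a⁺ ∷ a⁻ ∷ b⁺ ∷ m ∷ c ∷ g ∷ []))))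
  undershoot (inj₂ s<r+q) with m≤n⇒∃[o]m+o≡n s<r+q | suc c ≤? g
  ... | _ , _ | yes c<g with m≤n⇒∃[o]m+o≡n c<g
  ...   | h , refl = inj₁ (≤-slack (2 + 2 * a⁻ + 2 * b⁺ + 2 * c + c * q + c * u + 2 * h + h * r + h * u + q + u)
          (+-cancel-≡ E (solve (r ∷ u ∷ q ∷ i ∷ a⁺ ∷ a⁻ ∷ b⁺ ∷ m ∷ c ∷ h ∷ []))))
  undershoot (inj₂ s<r+q) | e , e-eq | no c≮g with m≤n⇒∃[o]m+o≡n (≰⇒> c≮g)
  ...   | h , refl = inj₂ (≤-slack (2 * a⁺ + 2 * b⁺ + e + e * g + e * h + 2 * g + 2 * h + h * r + h * u)
          (+-cancel-≡ (cong₂ _+_ (sym E) (cong (suc (g + h) *_) e-eq))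
            (solve (r ∷ u ∷ q ∷ e ∷ i ∷ a⁺ ∷ a⁻ ∷ b⁺ ∷ m ∷ g ∷ h ∷ []))))
tent-windingUp r u q i a⁺ a⁻ b⁺ b⁻ m c H q≥2 E | no ≰b⁻
  with m≤n⇒∃[o]m+o≡n (≰⇒> ≰b⁻) | m≤n⇒∃[o]m+o≡n q≥2
... | d , D | q′ , refl = inj₂ (≤-slack (2 * a⁺ + 2 * b⁺ + 2 * c + c * q′ + c * r + d * r + d * u + q′ + r)
      (+-cancel-≡ (cong₂ _+_ (sym E) (cong₂ _+_ (cong (_* suc (r + u)) D) (sym D)))
        (solve (r ∷ u ∷ q′ ∷ i ∷ a⁺ ∷ a⁻ ∷ b⁺ ∷ b⁻ ∷ m ∷ c ∷ d ∷ []))))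

lift-tentBound : ∀ {s q r v k} → r < s → r ≤ q ⊎ s + 1 ≤ r + q → 2 ≤ q →
  Lift (q * s + r) s v k → TentBound s v k
lift-tentBound {q = q} {r} {v} r<s H q≥2 (lift a⁺ a⁻ b⁺ b⁻ m⁻ m⁺ eq bd) with m≤n⇒∃[o]m+o≡n r<s
... | u , refl = TentBound-mono {s = suc (r + u)} bd (by-winding (m⁺ ≤? m⁻))
  where
  by-winding : Dec (m⁺ ≤ m⁻) → TentBound (suc (r + u)) v (a⁺ + a⁻ + b⁺ + b⁻)
  by-winding (yes m⁺≤m⁻) with m≤n⇒∃[o]m+o≡n m⁺≤m⁻
  ... | c , refl = tent-windingDown r u q v a⁺ a⁻ b⁺ b⁻ m⁺ c H eq
  by-winding (no m⁺≰m⁻) with m≤n⇒∃[o]m+o≡n (≰⇒> m⁺≰m⁻)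
  ... | c , refl = tent-windingUp r u q v a⁺ a⁻ b⁺ b⁻ m⁻ c H q≥2 eq

sum-applyUpTo-+ : ∀ (f : ℕ → ℕ) m n →
  sum (applyUpTo f (m + n)) ≡ sum (applyUpTo f m) + sum (applyUpTo (f ∘ (m +_)) n)
sum-applyUpTo-+ f zero    n = refl
sum-applyUpTo-+ f (suc m) n =
  trans (cong (f 0 +_) (sum-applyUpTo-+ (f ∘ suc) m n)) (sym (+-assoc (f 0) _ _))

sum-applyUpTo-suc : ∀ (f : ℕ → ℕ) m → sum (applyUpTo f (suc m)) ≡ sum (applyUpTo f m) + (f m + 0)
sum-applyUpTo-suc f m = trans (cong sum (sym (applyUpTo-∷ʳ f m))) (sum-++ (applyUpTo f m) (f m ∷ []))

tent-positive : ∀ {c s i x} → i < s → c + suc i ≤ x ⊎ c + (s + 1) ≤ suc i + x → c + 1 ≤ x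
tent-positive {c} {s} {i} {x} _ (inj₁ le) = ≤-trans (+-monoʳ-≤ c (s≤s z≤n)) le
tent-positive {c} {s} {i} {x} i<s (inj₂ le) with m≤n⇒∃[o]m+o≡n i<s
... | e , refl = +-cancelˡ-≤ (suc i) (c + 1) x (≤-trans (≤-slack e shift) le)
  where
  shift : c + (suc i + e + 1) ≡ suc i + (c + 1) + e
  shift = solve (c ∷ i ∷ e ∷ [])

-- h i ≥ c + min(i + 1, s − i); removing both ends leaves the same situation for s − 2 and c + 1.
sum-tent : ∀ s c (h : ℕ → ℕ) → (∀ i → i < s → c + suc i ≤ h i ⊎ c + (s + 1) ≤ suc i + h i) →
  4 * c * s + (s + 1) * (s + 1) ≤ 4 * sum (applyUpTo h s) + 1
sum-tent zero c h _ = ≤-reflexive (solve (c ∷ []))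
sum-tent (suc zero) c h bound = single (tent-positive {s = 1} (s≤s z≤n) (bound 0 (s≤s z≤n)))
  where
  single : ∀ {x} → c + 1 ≤ x → 4 * c * 1 + (1 + 1) * (1 + 1) ≤ 4 * (x + 0) + 1
  single c<x with m≤n⇒∃[o]m+o≡n c<x
  ... | x′ , refl = ≤-slack (4 * x′ + 1) (solve (c ∷ x′ ∷ []))
sum-tent (suc (suc s)) c h bound =
  subst (λ t → 4 * c * suc (suc s) + (suc (suc s) + 1) * (suc (suc s) + 1) ≤ 4 * (h 0 + t) + 1)
    (sym (sum-applyUpTo-suc (h ∘ suc) s))
    (add-ends (sum (applyUpTo (h ∘ suc) s))
              (tent-positive {s = suc (suc s)} (s≤s z≤n) (bound 0 (s≤s z≤n)))
              (tent-positive {s = suc (suc s)} ≤-refl (bound (suc s) ≤-refl))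
              (sum-tent s (suc c) (h ∘ suc) inner))
  where
  inner : ∀ i → i < s → suc c + suc i ≤ h (suc i) ⊎ suc c + (s + 1) ≤ suc i + h (suc i)
  inner i i<s with bound (suc i) (s≤s (≤-trans i<s (n≤1+n s)))
  ... | inj₁ le = inj₁ (subst (_≤ h (suc i)) (+-suc c (suc i)) le)
  ... | inj₂ le = inj₂ (s≤s⁻¹ (subst (_≤ suc (suc i + h (suc i))) shift le))
    where
    shift : c + (suc (suc s) + 1) ≡ suc (suc c + (s + 1))
    shift = solve (c ∷ s ∷ [])

  add-ends : ∀ {x y} B → c + 1 ≤ x → c + 1 ≤ y →
    4 * suc c * s + (s + 1) * (s + 1) ≤ 4 * B + 1 →
    4 * c * suc (suc s) + (suc (suc s) + 1) * (suc (suc s) + 1) ≤ 4 * (x + (B + (y + 0))) + 1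
  add-ends B c<x c<y inner-bound
    with m≤n⇒∃[o]m+o≡n c<x | m≤n⇒∃[o]m+o≡n c<y | m≤n⇒∃[o]m+o≡n inner-bound
  ... | x′ , refl | y′ , refl | z , Z = ≤-slack (4 * x′ + 4 * y′ + z)
    (+-cancel-≡ Z (solve (s ∷ c ∷ x′ ∷ y′ ∷ B ∷ z ∷ [])))

sum-twoBlocks : ∀ (f : ℕ → ℕ) m w →
  sum (applyUpTo (f ∘ suc) m) + sum (applyUpTo (λ i → f (suc (m + (w + i)))) m)
    ≤ sum (applyUpTo f (suc (m + (w + m))))
sum-twoBlocks f m w =
  subst (A + B ≤_) (sym (cong (f 0 +_) split)) (drop-middle (f 0) A G B)
  where
  A B G : ℕ
  A = sum (applyUpTo (f ∘ suc) m)
  B = sum (applyUpTo (λ i → f (suc (m + (w + i)))) m)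
  G = sum (applyUpTo (λ i → f (suc (m + i))) w)

  split : sum (applyUpTo (f ∘ suc) (m + (w + m))) ≡ A + (G + B)
  split = trans (sum-applyUpTo-+ (f ∘ suc) m (w + m))
                (cong (A +_) (sum-applyUpTo-+ (λ i → f (suc (m + i))) w m))

  drop-middle : ∀ x a y b → a + b ≤ x + (a + (y + b))
  drop-middle x a y b = ≤-slack (x + y) (solve (x ∷ a ∷ y ∷ b ∷ []))

half-≤ : ∀ {X} R₁ R₂ → X ≤ 4 * R₁ + 1 → X ≤ 4 * R₂ + 1 → X / 2 ≤ R₁ + R₂
half-≤ {X} R₁ R₂ p₁ p₂ = s≤s⁻¹ (m<n*o⇒m/o<n {X} {suc (R₁ + R₂)} {2} X<)
  where
  double : 2 * X ≤ 2 * (2 * (R₁ + R₂) + 1)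
  double = subst₂ _≤_ twice sum-bound (+-mono-≤ p₁ p₂)
    where
    twice : X + X ≡ 2 * X
    twice = solve (X ∷ [])
    sum-bound : 4 * R₁ + 1 + (4 * R₂ + 1) ≡ 2 * (2 * (R₁ + R₂) + 1)
    sum-bound = solve (R₁ ∷ R₂ ∷ [])

  X< : X < suc (R₁ + R₂) * 2
  X< = subst (X <_) bound (s≤s (*-cancelˡ-≤ 2 double))
    where
    bound : suc (2 * (R₁ + R₂) + 1) ≡ suc (R₁ + R₂) * 2
    bound = solve (R₁ ∷ R₂ ∷ [])

quotient≥2 : ∀ {s q r} → r < s → 2 * s < q * s + r → 2 ≤ q
quotient≥2 {s} {q} {r} r<s 2s<n = s≤s⁻¹ (*-cancelʳ-< s 2 (suc q) (<-trans 2s<n n<s+qs))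
  where
  n<s+qs : q * s + r < s + q * s
  n<s+qs = subst (q * s + r <_) (+-comm (q * s) s) (+-monoʳ-< (q * s) r<s)

-- The two blocks are the vertices 1, …, s and n − s, …, n − 1, where n = 2s + 1 + w.
half-square≤sum : ∀ s w (d : ℕ → ℕ) →
  (∀ i → i < s → TentBound s (suc i) (d (suc i))) →
  (∀ i → i < s → TentBound s (suc i) (d (suc (s + (w + i))))) →
  ((s + 1) * (s + 1)) / 2 ≤ sum (applyUpTo d (suc (s + (w + s))))
half-square≤sum s w d low-tent high-tent = begin
  ((s + 1) * (s + 1)) / 2
    ≤⟨ half-≤ (sum (applyUpTo low s)) (sum (applyUpTo high s))
              (sum-tent s 0 low low-tent) (sum-tent s 0 high high-tent) ⟩
  sum (applyUpTo low s) + sum (applyUpTo high s)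
    ≤⟨ sum-twoBlocks d s w ⟩
  sum (applyUpTo d (suc (s + (w + s)))) ∎
  where
  open ≤-Reasoning
  low high : ℕ → ℕ
  low i = d (suc i)
  high i = d (suc (s + (w + i)))

lemma2p6 : (n s q r : ℕ) → 5 ≤ n → 1 < s → 2 * s < n →
    q * s + r ≡ n → r < s →
    (r ≤ q ⊎ s + 1 ≤ r + q) →
    (d : ℕ → ℕ) → IsDistFrom0 n s d →
    ((s + 1) * (s + 1)) / 2 ≤ distSum n d
lemma2p6 _ s q r _ _ 2s<n refl r<s admissible d isDist with m≤n⇒∃[o]m+o≡n 2s<n
... | w , w-eq = subst (((s + 1) * (s + 1)) / 2 ≤_) sum≡distSum (half-square≤sum s w d low-tent high-tent)
  where
  N = q * s + r

  n≡ : suc (s + (w + s)) ≡ N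
  n≡ = trans twice-s w-eq
    where
    twice-s : suc (s + (w + s)) ≡ suc (2 * s) + w
    twice-s = solve (s ∷ w ∷ [])

  sum≡distSum : sum (applyUpTo d (suc (s + (w + s)))) ≡ distSum N d
  sum≡distSum = trans (cong (sum ∘ applyUpTo d) n≡) (sym (cong sum (map-upTo d N)))

  dist-lift : ∀ {v} → v < N → Lift N s v (d v)
  dist-lift v<N = walk⇒lift (proj₁ (isDist _ v<N))

  lift-bound : ∀ {v k} → Lift N s v k → TentBound s v k
  lift-bound = lift-tentBound r<s admissible (quotient≥2 r<s 2s<n)

  low-tent : ∀ i → i < s → TentBound s (suc i) (d (suc i))
  low-tent i i<s = lift-bound (dist-lift (≤-<-trans i<s (≤-<-trans (m≤m+n s (s + 0)) 2s<n)))

  high-tent : ∀ i → i < s → TentBound s (suc i) (d (suc (s + (w + i))))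
  high-tent i i<s with m≤n⇒∃[o]m+o≡n i<s
  ... | k , refl = TentBound-reflect {s = suc i + k} mirror
    (lift-bound (lift-neg (trans complement n≡)
      (dist-lift (subst (suc (s + (w + i)) <_) n≡ (s≤s (+-monoʳ-< s (+-monoʳ-< w i<s)))))))
    where
    mirror : suc k + suc i ≡ suc i + k + 1
    mirror = solve (i ∷ k ∷ [])
    complement : suc (suc i + k + (w + i)) + suc k ≡ suc (suc i + k + (w + (suc i + k)))
    complement = solve (i ∷ k ∷ w ∷ [])
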